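{- Let $n,m,k,\ell,c$ be positive integers with $n=k+\ell<m$, and consider the equation $x^n+y^m=c\,x^k y^\ell$ in positive integers $x,y$. (i) If $c=1$, the equation has no positive integer solutions. (ii) If $c\ge 2$, let $M$ be the largest positive integer $u$ with $u^{n-k}<c$. Then a pair $(x,y)$ of positive integers is a solution if and only if there exist positive integers $x_1,r,d$ such that $1\le x_1\le M$, $x_1^{n-k}+r=c$, $d^{m-n}=r\,x_1^k$, $x=d\,x_1$ and $y=d$. (iii) If $c=2$, $(x,y)=(1,1)$ is the unique solution. (iv) If $c=3$, $n-k\ge 2$ and $m-n=1$, then $(x,y)=(2,2)$ is the unique solution. (v) If $c=3$, $n-k\ge 2$ and $m-n\ge 2$, the equation has no positive integer solutions. (vi) If $c=3$, $n-k=1$ (i.e. $\ell=1$) and $m-n=1$, the equation has exactly two solutions, namely $(x,y)=(2,2)$ and $(x,y)=(2^{k+1},2^k)$. (vii) If $c=3$, $n-k=1$ (i.e. $\ell=1$) and $m-n\ge 2$, the equation has no positive integer solutions unless there exist positive integers $\rho,v$ with $k=\rho v$, $m=\ell+v\rho+v$ and $n=\rho v+\ell$; if such $\rho,v$ exist, the equation has the unique solution $(x,y)=(2^{\rho+1},2^{\rho})$.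
   Context: A solution means an ordered pair $(x,y)$ of positive integers satisfying the equation. -}

module Defs where

open import Data.Nat using (ℕ; _+_; _*_; _^_; _≤_; _<_; _≡ᵇ_)
open import Data.Product using (_×_)
open import Relation.Binary.PropositionalEquality using (_≡_)

Eqn : (n m k ℓ c x y : ℕ) → Set
Eqn n m k ℓ c x y = x ^ n + y ^ m ≡ c * x ^ k * y ^ ℓ

IsLargestBelow : (e c M : ℕ) → Set
IsLargestBelow e c M = 1 ≤ M × M ^ e < c × (∀ u → 1 ≤ u → u ^ e < c → u ≤ M)

-- Write n = k + ℓ and m = n + e.  Dividing a solution by g = gcd x y, with x = a g and
-- y = b g, leaves a^n + g^e b^m = c a^k b^ℓ; b divides a^n and is coprime to a, so b = 1.
-- Then a^k divides g^e, say g^e = r a^k, and a^ℓ + r = c: every solution is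
-- (x, y) = (d x₁, d) with x₁^ℓ + r = c and d^e = r x₁^k, and conversely.  For c = 2 and
-- c = 3 the first equation leaves only a handful of pairs (x₁, r), and the second becomes
-- d^e = 2 or d^e = 2^k, whose solutions are powers of 2.
module Submission where

open import Defs
open import Data.Nat
open import Data.Nat.Properties
open import Data.Nat.Divisibility
open import Data.Nat.DivMod using (_/_; m/n*n≡m)
open import Data.Nat.GCD using (gcd; gcd[m,n]∣m; gcd[m,n]∣n; gcd[m,n]≢0; m/gcd[m,n]≢0)
open import Data.Nat.Coprimality as Coprimality using (Coprime; coprime-/gcd; coprime-divisor)
open import Data.Nat.Primality using (Prime; prime[2]; ¬prime[1]; euclidsLemma; prime⇒nonZero; prime⇒nonTrivial)
open import Data.Nat.Induction using (<-wellFounded)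
open import Data.Nat.Tactic.RingSolver using (solve-∀)
open import Algebra.Properties.CommutativeSemigroup *-commutativeSemigroup using (interchange)
open import Induction.WellFounded using (Acc; acc)
open import Data.Product using (_×_; _,_; ∃-syntax)
open import Data.Sum using (_⊎_; inj₁; inj₂; [_,_]′)
open import Data.Empty using (⊥-elim)
open import Function using (id; _∘_)
open import Function.Bundles using (_⇔_; mk⇔; Equivalence)
open import Function.Properties.Equivalence using () renaming (trans to ⇔-trans)
open import Relation.Nullary using (¬_)
open import Relation.Binary.PropositionalEquality

open Equivalence using (to)

^-distribʳ-* : ∀ a b n → (a * b) ^ n ≡ a ^ n * b ^ n
^-distribʳ-* a b zero    = refl
^-distribʳ-* a b (suc n) =
  trans (cong (a * b *_) (^-distribʳ-* a b n)) (interchange a b (a ^ n) (b ^ n))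

m∣m^n : ∀ m {n} → 1 ≤ n → m ∣ m ^ n
m∣m^n m {suc n} _ = m∣m*n (m ^ n)

coprime∧∣^⇒≡1 : ∀ {b a} n → Coprime b a → b ∣ a ^ n → b ≡ 1
coprime∧∣^⇒≡1 zero    _   b∣1     = ∣1⇒≡1 b∣1
coprime∧∣^⇒≡1 (suc n) cop b∣a*aⁿ = coprime∧∣^⇒≡1 n cop (coprime-divisor cop b∣a*aⁿ)

prime∣^⇒∣ : ∀ {p d} n → Prime p → p ∣ d ^ n → p ∣ d
prime∣^⇒∣         zero    p-prime p∣1    = ⊥-elim (¬prime[1] (subst Prime (∣1⇒≡1 p∣1) p-prime))
prime∣^⇒∣ {d = d} (suc n) p-prime p∣d*dⁿ =
  [ id , prime∣^⇒∣ n p-prime ]′ (euclidsLemma d (d ^ n) p-prime p∣d*dⁿ)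

root-of-prime-power-step : ∀ {p e d k} → Prime p → 1 ≤ k → d ^ e ≡ p ^ k →
  ∃[ q ] (d ≡ q * p × e ≤ k × q ^ e ≡ p ^ (k ∸ e))
root-of-prime-power-step {p} {e} {d} {k@(suc k′)} p-prime _ dᵉ≡pᵏ
  with prime∣^⇒∣ e p-prime (subst (p ∣_) (sym dᵉ≡pᵏ) (m∣m*n (p ^ k′)))
... | divides q d≡q*p = q , d≡q*p , e≤k , qᵉ≡pᵏ⁻ᵉ
  where
  qᵉ*pᵉ≡pᵏ : q ^ e * p ^ e ≡ p ^ k
  qᵉ*pᵉ≡pᵏ = trans (sym (^-distribʳ-* q p e)) (trans (cong (_^ e) (sym d≡q*p)) dᵉ≡pᵏ)
  instance
    p≢0 : NonZero p
    p≢0 = prime⇒nonZero p-prime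
    qᵉ≢0 : NonZero (q ^ e)
    qᵉ≢0 = ≢-nonZero λ qᵉ≡0 →
      ≢-nonZero⁻¹ (p ^ k) {{m^n≢0 p k}} (trans (sym qᵉ*pᵉ≡pᵏ) (cong (_* p ^ e) qᵉ≡0))
  e≤k : e ≤ k
  e≤k = ≮⇒≥ λ k<e →
    <⇒≱ (^-monoʳ-< p (nonTrivial⇒n>1 p {{prime⇒nonTrivial p-prime}}) k<e)
        (subst (p ^ e ≤_) qᵉ*pᵉ≡pᵏ (m≤n*m (p ^ e) (q ^ e)))
  qᵉ≡pᵏ⁻ᵉ : q ^ e ≡ p ^ (k ∸ e)
  qᵉ≡pᵏ⁻ᵉ = *-cancelʳ-≡ _ _ (p ^ e) {{m^n≢0 p e}} (begin
    q ^ e * p ^ e        ≡⟨ qᵉ*pᵉ≡pᵏ ⟩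
    p ^ k                ≡⟨ cong (p ^_) (m∸n+n≡m e≤k) ⟨
    p ^ (k ∸ e + e)      ≡⟨ ^-distribˡ-+-* p (k ∸ e) e ⟩
    p ^ (k ∸ e) * p ^ e  ∎)
    where open ≡-Reasoning

root-of-prime-power : ∀ {p e} → Prime p → 1 ≤ e →
  ∀ d k → d ^ e ≡ p ^ k → ∃[ j ] (d ≡ p ^ j × k ≡ j * e)
root-of-prime-power {p} {e} p-prime e≥1 d k = go d k (<-wellFounded k)
  where
  go : ∀ d k → Acc _<_ k → d ^ e ≡ p ^ k → ∃[ j ] (d ≡ p ^ j × k ≡ j * e)
  go d zero _ dᵉ≡1 with m^n≡1⇒n≡0∨m≡1 d e dᵉ≡1
  ... | inj₁ refl = ⊥-elim (<-irrefl refl e≥1)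
  ... | inj₂ d≡1  = 0 , d≡1 , refl
  go d k@(suc _) (acc smaller) dᵉ≡pᵏ
    with root-of-prime-power-step p-prime (s≤s z≤n) dᵉ≡pᵏ
  ... | q , d≡q*p , e≤k , qᵉ≡pᵏ⁻ᵉ
    with go q (k ∸ e) (smaller (∸-monoʳ-< e≥1 e≤k)) qᵉ≡pᵏ⁻ᵉ
  ...   | j , q≡pʲ , k∸e≡j*e =
    suc j ,
    trans d≡q*p (trans (cong (_* p) q≡pʲ) (*-comm (p ^ j) p)) ,
    trans (sym (m+[n∸m]≡n e≤k)) (cong (e +_) k∸e≡j*e)

m^n≡2⇒m≡2∧n≡1 : ∀ m n → m ^ n ≡ 2 → m ≡ 2 × n ≡ 1
m^n≡2⇒m≡2∧n≡1 m zero    ()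
m^n≡2⇒m≡2∧n≡1 m n@(suc _) mⁿ≡2 =
  let j , m≡2ʲ , 1≡j*n = root-of-prime-power {e = n} prime[2] (s≤s z≤n) m 1 mⁿ≡2
  in trans m≡2ʲ (cong (2 ^_) (m*n≡1⇒m≡1 j n (sym 1≡j*n))) , m*n≡1⇒n≡1 j n (sym 1≡j*n)

-- The solutions described in (ii), without the bound x₁ ≤ M; here ℓ = n − k and e = m − n.
record Parametrised (c k ℓ e x y : ℕ) : Set where
  constructor parametrised
  field
    x₁ r d   : ℕ
    x₁≥1     : 1 ≤ x₁
    r≥1      : 1 ≤ r
    d≥1      : 1 ≤ d
    x₁ˡ+r≡c  : x₁ ^ ℓ + r ≡ c
    dᵉ≡r*x₁ᵏ : d ^ e ≡ r * x₁ ^ k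
    x≡d*x₁   : x ≡ d * x₁
    y≡d      : y ≡ d

solution-divide-common-factor : ∀ {k ℓ e c a b g} .{{_ : NonZero g}} →
  Eqn (k + ℓ) (k + ℓ + e) k ℓ c (a * g) (b * g) →
  a ^ (k + ℓ) + g ^ e * b ^ (k + ℓ + e) ≡ c * a ^ k * b ^ ℓ
solution-divide-common-factor {k} {ℓ} {e} {c} {a} {b} {g} eqn =
  *-cancelʳ-≡ _ _ (g ^ n) {{m^n≢0 g n}} (begin
    (a ^ n + g ^ e * b ^ m) * g ^ n          ≡⟨ distrib (a ^ n) (b ^ m) (g ^ n) (g ^ e) ⟩
    a ^ n * g ^ n + b ^ m * (g ^ n * g ^ e)  ≡⟨ cong₂ _+_ (^-distribʳ-* a g n) (cong (b ^ m *_) (^-distribˡ-+-* g n e)) ⟨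
    (a * g) ^ n + b ^ m * g ^ m              ≡⟨ cong ((a * g) ^ n +_) (^-distribʳ-* b g m) ⟨
    (a * g) ^ n + (b * g) ^ m                ≡⟨ eqn ⟩
    c * (a * g) ^ k * (b * g) ^ ℓ            ≡⟨ cong₂ (λ u v → c * u * v) (^-distribʳ-* a g k) (^-distribʳ-* b g ℓ) ⟩
    c * (a ^ k * g ^ k) * (b ^ ℓ * g ^ ℓ)    ≡⟨ regroup c (a ^ k) (g ^ k) (b ^ ℓ) (g ^ ℓ) ⟩
    c * a ^ k * b ^ ℓ * (g ^ k * g ^ ℓ)      ≡⟨ cong (c * a ^ k * b ^ ℓ *_) (^-distribˡ-+-* g k ℓ) ⟨
    c * a ^ k * b ^ ℓ * g ^ n                ∎)
  where
  open ≡-Reasoning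
  n = k + ℓ
  m = n + e
  distrib : ∀ A B G E → (A + E * B) * G ≡ A * G + B * (G * E)
  distrib = solve-∀
  regroup : ∀ C A G B H → C * (A * G) * (B * H) ≡ C * A * B * (G * H)
  regroup = solve-∀

coprime-solution⇒base≡1 : ∀ {k ℓ e c a b g} → 1 ≤ ℓ → Coprime a b →
  a ^ (k + ℓ) + g ^ e * b ^ (k + ℓ + e) ≡ c * a ^ k * b ^ ℓ → b ≡ 1
coprime-solution⇒base≡1 {k} {ℓ} {e} {c} {a} {b} {g} ℓ≥1 cop eqn =
  coprime∧∣^⇒≡1 (k + ℓ) (Coprimality.sym cop) (∣m+n∣m⇒∣n b∣sum b∣gᵉ*bᵐ)
  where
  b∣sum : b ∣ g ^ e * b ^ (k + ℓ + e) + a ^ (k + ℓ)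
  b∣sum = subst (b ∣_) (trans (sym eqn) (+-comm (a ^ (k + ℓ)) _)) (∣n⇒∣m*n (c * a ^ k) (m∣m^n b ℓ≥1))
  b∣gᵉ*bᵐ : b ∣ g ^ e * b ^ (k + ℓ + e)
  b∣gᵉ*bᵐ = ∣n⇒∣m*n (g ^ e) (m∣m^n b (≤-trans ℓ≥1 (≤-trans (m≤n+m ℓ k) (m≤m+n (k + ℓ) e))))

reduced-solution⇒parametrised : ∀ {k ℓ e c a g} .{{_ : NonZero a}} .{{_ : NonZero g}} →
  a ^ (k + ℓ) + g ^ e ≡ c * a ^ k → Parametrised c k ℓ e (a * g) g
reduced-solution⇒parametrised {k} {ℓ} {e} {c} {a} {g} eqn with aᵏ∣gᵉ
  where
  aᵏ∣gᵉ : a ^ k ∣ g ^ e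
  aᵏ∣gᵉ = ∣m+n∣m⇒∣n
    (subst (a ^ k ∣_) (trans (sym eqn) (cong (_+ g ^ e) (^-distribˡ-+-* a k ℓ))) (n∣m*n c))
    (m∣m*n (a ^ ℓ))
... | divides zero    gᵉ≡0 = ⊥-elim (≢-nonZero⁻¹ (g ^ e) {{m^n≢0 g e}} gᵉ≡0)
... | divides r@(suc _) gᵉ≡r*aᵏ =
  parametrised a r g (>-nonZero⁻¹ a) (s≤s z≤n) (>-nonZero⁻¹ g) aˡ+r≡c gᵉ≡r*aᵏ (*-comm a g) refl
  where
  open ≡-Reasoning
  aˡ+r≡c : a ^ ℓ + r ≡ c
  aˡ+r≡c = *-cancelʳ-≡ _ _ (a ^ k) {{m^n≢0 a k}} (begin
    (a ^ ℓ + r) * a ^ k        ≡⟨ *-distribʳ-+ (a ^ k) (a ^ ℓ) r ⟩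
    a ^ ℓ * a ^ k + r * a ^ k  ≡⟨ cong₂ _+_ (*-comm (a ^ k) (a ^ ℓ)) gᵉ≡r*aᵏ ⟨
    a ^ k * a ^ ℓ + g ^ e      ≡⟨ cong (_+ g ^ e) (^-distribˡ-+-* a k ℓ) ⟨
    a ^ (k + ℓ) + g ^ e        ≡⟨ eqn ⟩
    c * a ^ k                  ∎)

coprime-solution⇒parametrised : ∀ {k ℓ e c a b g} .{{_ : NonZero a}} .{{_ : NonZero g}} →
  1 ≤ ℓ → Coprime a b → Eqn (k + ℓ) (k + ℓ + e) k ℓ c (a * g) (b * g) →
  Parametrised c k ℓ e (a * g) (b * g)
coprime-solution⇒parametrised {k} {ℓ} {e} {c} {a} {b} {g} ℓ≥1 cop eqn
  with coprime-solution⇒base≡1 {k} {ℓ} {e} {c} {a} {b} {g} ℓ≥1 cop reduced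
  where
  reduced = solution-divide-common-factor {k} {ℓ} {e} {c} {a} {b} {g} eqn
... | refl = subst (Parametrised c k ℓ e (a * g)) (sym (*-identityˡ g))
  (reduced-solution⇒parametrised (begin
    a ^ n + g ^ e                ≡⟨ cong (a ^ n +_) (*-identityʳ (g ^ e)) ⟨
    a ^ n + g ^ e * 1            ≡⟨ cong (λ u → a ^ n + g ^ e * u) (^-zeroˡ (n + e)) ⟨
    a ^ n + g ^ e * 1 ^ (n + e)  ≡⟨ solution-divide-common-factor {k} {ℓ} {e} {c} {a} {1} {g} eqn ⟩
    c * a ^ k * 1 ^ ℓ            ≡⟨ cong (c * a ^ k *_) (^-zeroˡ ℓ) ⟩
    c * a ^ k * 1                ≡⟨ *-identityʳ (c * a ^ k) ⟩
    c * a ^ k                    ∎))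
  where
  open ≡-Reasoning
  n = k + ℓ

solution⇒parametrised : ∀ {k ℓ e c x y} → 1 ≤ ℓ → 1 ≤ x →
  Eqn (k + ℓ) (k + ℓ + e) k ℓ c x y → Parametrised c k ℓ e x y
solution⇒parametrised {k} {ℓ} {e} {c} {x} {y} ℓ≥1 x≥1 eqn =
  subst₂ (Parametrised c k ℓ e) x/g*g≡x y/g*g≡y
    (coprime-solution⇒parametrised ℓ≥1 (coprime-/gcd x y)
      (subst₂ (Eqn (k + ℓ) (k + ℓ + e) k ℓ c) (sym x/g*g≡x) (sym y/g*g≡y) eqn))
  where
  instance
    x≢0 : NonZero x
    x≢0 = >-nonZero x≥1
    g≢0 : NonZero (gcd x y)
    g≢0 = ≢-nonZero (gcd[m,n]≢0 x y (inj₁ (≢-nonZero⁻¹ x)))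
    x/g≢0 : NonZero (x / gcd x y)
    x/g≢0 = ≢-nonZero (m/gcd[m,n]≢0 x y)
  x/g*g≡x : x / gcd x y * gcd x y ≡ x
  x/g*g≡x = m/n*n≡m (gcd[m,n]∣m x y)
  y/g*g≡y : y / gcd x y * gcd x y ≡ y
  y/g*g≡y = m/n*n≡m (gcd[m,n]∣n x y)

parametrised⇒solution : ∀ {k ℓ e c x y} → Parametrised c k ℓ e x y →
  Eqn (k + ℓ) (k + ℓ + e) k ℓ c x y
parametrised⇒solution {k} {ℓ} {e} (parametrised x₁ r d _ _ _ refl dᵉ≡r*x₁ᵏ refl refl) = begin
  (d * x₁) ^ (k + ℓ) + d ^ (k + ℓ + e)
    ≡⟨ cong₂ _+_ (trans (^-distribʳ-* d x₁ (k + ℓ)) (cong₂ _*_ (^-distribˡ-+-* d k ℓ) (^-distribˡ-+-* x₁ k ℓ)))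
                 (trans (^-distribˡ-+-* d (k + ℓ) e) (cong₂ _*_ (^-distribˡ-+-* d k ℓ) dᵉ≡r*x₁ᵏ)) ⟩
  d ^ k * d ^ ℓ * (x₁ ^ k * x₁ ^ ℓ) + d ^ k * d ^ ℓ * (r * x₁ ^ k)
    ≡⟨ factor (d ^ k) (d ^ ℓ) (x₁ ^ k) (x₁ ^ ℓ) r ⟩
  (x₁ ^ ℓ + r) * (d ^ k * x₁ ^ k) * d ^ ℓ
    ≡⟨ cong (λ u → (x₁ ^ ℓ + r) * u * d ^ ℓ) (^-distribʳ-* d x₁ k) ⟨
  (x₁ ^ ℓ + r) * (d * x₁) ^ k * d ^ ℓ ∎
  where
  open ≡-Reasoning
  factor : ∀ Dk Dl Xk Xl r → Dk * Dl * (Xk * Xl) + Dk * Dl * (r * Xk) ≡ (Xl + r) * (Dk * Xk) * Dl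
  factor = solve-∀

solution⇔parametrised : ∀ {k ℓ e c x y} → 1 ≤ ℓ → 1 ≤ x →
  Eqn (k + ℓ) (k + ℓ + e) k ℓ c x y ⇔ Parametrised c k ℓ e x y
solution⇔parametrised {k} {ℓ} {e} {c} ℓ≥1 x≥1 =
  mk⇔ (solution⇒parametrised ℓ≥1 x≥1) (parametrised⇒solution {k} {ℓ} {e} {c})

parametrised⇒2≤c : ∀ {c k ℓ e x y} → Parametrised c k ℓ e x y → 2 ≤ c
parametrised⇒2≤c {ℓ = ℓ} (parametrised x₁ _ _ x₁≥1 r≥1 _ x₁ˡ+r≡c _ _ _) =
  subst (2 ≤_) x₁ˡ+r≡c (+-mono-≤ (m^n>0 x₁ {{>-nonZero x₁≥1}} ℓ) r≥1)

parametrised⇔bounded : ∀ {c k ℓ e x y M} → IsLargestBelow ℓ c M →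
  Parametrised c k ℓ e x y ⇔ (∃[ x₁ ] ∃[ r ] ∃[ d ] (1 ≤ x₁ × 1 ≤ r × 1 ≤ d × x₁ ≤ M
    × x₁ ^ ℓ + r ≡ c × d ^ e ≡ r * x₁ ^ k × x ≡ d * x₁ × y ≡ d))
parametrised⇔bounded {ℓ = ℓ} (_ , _ , maximal) = mk⇔
  (λ (parametrised x₁ r d x₁≥1 r≥1 d≥1 x₁ˡ+r≡c dᵉ≡r*x₁ᵏ x≡d*x₁ y≡d) →
    x₁ , r , d , x₁≥1 , r≥1 , d≥1 ,
    maximal x₁ x₁≥1 (subst (x₁ ^ ℓ <_) x₁ˡ+r≡c (m<m+n (x₁ ^ ℓ) r≥1)) ,
    x₁ˡ+r≡c , dᵉ≡r*x₁ᵏ , x≡d*x₁ , y≡d)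
  (λ (x₁ , r , d , x₁≥1 , r≥1 , d≥1 , _ , x₁ˡ+r≡c , dᵉ≡r*x₁ᵏ , x≡d*x₁ , y≡d) →
    parametrised x₁ r d x₁≥1 r≥1 d≥1 x₁ˡ+r≡c dᵉ≡r*x₁ᵏ x≡d*x₁ y≡d)

-- If c ≤ 2^ℓ then x₁ ≥ 2 would give x₁^ℓ ≥ c, so x₁ = 1 and r = c − 1.
parametrised-c≤2^ℓ : ∀ {c k ℓ e x y} → c ≤ 2 ^ ℓ → Parametrised c k ℓ e x y →
  x ≡ y × suc (y ^ e) ≡ c
parametrised-c≤2^ℓ {c} {k} {ℓ} {e} _ (parametrised 1 r d _ _ _ 1ˡ+r≡c dᵉ≡r*1ᵏ refl refl) =
  *-identityʳ d , (begin
    suc (d ^ e)      ≡⟨ cong suc dᵉ≡r*1ᵏ ⟩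
    suc (r * 1 ^ k)  ≡⟨ cong (λ u → suc (r * u)) (^-zeroˡ k) ⟩
    suc (r * 1)      ≡⟨ cong suc (*-identityʳ r) ⟩
    1 + r            ≡⟨ cong (_+ r) (^-zeroˡ ℓ) ⟨
    1 ^ ℓ + r        ≡⟨ 1ˡ+r≡c ⟩
    c                ∎)
  where open ≡-Reasoning
parametrised-c≤2^ℓ {ℓ = ℓ} c≤2ˡ (parametrised x₁@(2+ _) r _ _ r≥1 _ x₁ˡ+r≡c _ _ _) =
  ⊥-elim (<⇒≱ (subst (x₁ ^ ℓ <_) x₁ˡ+r≡c (m<m+n (x₁ ^ ℓ) r≥1))
              (≤-trans c≤2ˡ (^-monoˡ-≤ ℓ (s≤s (s≤s z≤n)))))

parametrised[c≡2] : ∀ {k ℓ e x y} → 1 ≤ ℓ → 1 ≤ e → Parametrised 2 k ℓ e x y ⇔ (x ≡ 1 × y ≡ 1)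
parametrised[c≡2] {k} {ℓ} {e} {x} {y} ℓ≥1 e≥1 = mk⇔ only-unit unit
  where
  only-unit : Parametrised 2 k ℓ e x y → x ≡ 1 × y ≡ 1
  only-unit p with parametrised-c≤2^ℓ (^-monoʳ-≤ 2 ℓ≥1) p
  ... | x≡y , yᵉ+1≡2 with m^n≡1⇒n≡0∨m≡1 y e (suc-injective yᵉ+1≡2)
  ...   | inj₁ refl = ⊥-elim (<-irrefl refl e≥1)
  ...   | inj₂ y≡1  = trans x≡y y≡1 , y≡1
  unit : x ≡ 1 × y ≡ 1 → Parametrised 2 k ℓ e x y
  unit (refl , refl) = parametrised 1 1 1 (s≤s z≤n) (s≤s z≤n) (s≤s z≤n)
    (cong (_+ 1) (^-zeroˡ ℓ)) (trans (^-zeroˡ e) (sym (trans (*-identityˡ _) (^-zeroˡ k)))) refl refl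

parametrised[c≡3]-ℓ≥2 : ∀ {k ℓ e x y} → 2 ≤ ℓ → Parametrised 3 k ℓ e x y →
  x ≡ 2 × y ≡ 2 × e ≡ 1
parametrised[c≡3]-ℓ≥2 {e = e} {y = y} ℓ≥2 p with parametrised-c≤2^ℓ (≤-trans (n≤1+n 3) (^-monoʳ-≤ 2 ℓ≥2)) p
... | x≡y , yᵉ+1≡3 with m^n≡2⇒m≡2∧n≡1 y e (suc-injective yᵉ+1≡3)
...   | y≡2 , e≡1 = trans x≡y y≡2 , y≡2 , e≡1

sum≡3 : ∀ {a b} → 1 ≤ a → 1 ≤ b → a + b ≡ 3 → (a ≡ 1 × b ≡ 2) ⊎ (a ≡ 2 × b ≡ 1)
sum≡3 {1}                 _ _   refl  = inj₁ (refl , refl)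
sum≡3 {2}                 _ _   refl  = inj₂ (refl , refl)
sum≡3 {suc (suc (suc a))} _ b≥1 a+b≡3 =
  ⊥-elim (<-irrefl refl (subst (1 ≤_) (m+n≡0⇒n≡0 a (cong (_∸ 3) a+b≡3)) b≥1))

parametrised[c≡3]-ℓ≡1 : ∀ {k e x y} → 1 ≤ e → Parametrised 3 k 1 e x y →
  (x ≡ 2 × y ≡ 2 × e ≡ 1) ⊎ ∃[ j ] (x ≡ 2 ^ (j + 1) × y ≡ 2 ^ j × k ≡ j * e)
parametrised[c≡3]-ℓ≡1 {k} {e} e≥1 (parametrised x₁ r d x₁≥1 r≥1 _ x₁¹+r≡3 dᵉ≡r*x₁ᵏ refl refl)
  with sum≡3 x₁≥1 r≥1 (trans (cong (_+ r) (sym (*-identityʳ x₁))) x₁¹+r≡3)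
... | inj₁ (refl , refl) =
  let d≡2 , e≡1 = m^n≡2⇒m≡2∧n≡1 d e (trans dᵉ≡r*x₁ᵏ (cong (2 *_) (^-zeroˡ k)))
  in inj₁ (trans (*-identityʳ d) d≡2 , d≡2 , e≡1)
... | inj₂ (refl , refl) =
  let j , d≡2ʲ , k≡j*e = root-of-prime-power prime[2] e≥1 d k (trans dᵉ≡r*x₁ᵏ (*-identityˡ _))
  in inj₂ (j , trans (cong (_* 2) d≡2ʲ) (sym (^-distribˡ-+-* 2 j 1)) , d≡2ʲ , k≡j*e)

diagonal-parametrised : ∀ {k ℓ} → Parametrised 3 k ℓ 1 2 2
diagonal-parametrised {k} {ℓ} = parametrised 1 2 2 (s≤s z≤n) (s≤s z≤n) (s≤s z≤n)
  (cong (_+ 2) (^-zeroˡ ℓ)) (sym (cong (2 *_) (^-zeroˡ k))) refl refl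

power-of-two-parametrised : ∀ {k e} j → k ≡ j * e → Parametrised 3 k 1 e (2 ^ (j + 1)) (2 ^ j)
power-of-two-parametrised {k} {e} j k≡j*e = parametrised 2 1 (2 ^ j) (s≤s z≤n) (s≤s z≤n) (m^n>0 2 j) refl
  (trans (^-*-assoc 2 j e) (trans (cong (2 ^_) (sym k≡j*e)) (sym (*-identityˡ _))))
  (^-distribˡ-+-* 2 j 1) refl

parametrised[c≡3]-ℓ≥2-e≡1 : ∀ {k ℓ x y} → 2 ≤ ℓ → Parametrised 3 k ℓ 1 x y ⇔ (x ≡ 2 × y ≡ 2)
parametrised[c≡3]-ℓ≥2-e≡1 ℓ≥2 = mk⇔
  (λ p → let x≡2 , y≡2 , _ = parametrised[c≡3]-ℓ≥2 ℓ≥2 p in x≡2 , y≡2)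
  (λ { (refl , refl) → diagonal-parametrised })

parametrised[c≡3]-ℓ≡1-e≡1 : ∀ {k x y} →
  Parametrised 3 k 1 1 x y ⇔ ((x ≡ 2 × y ≡ 2) ⊎ (x ≡ 2 ^ (k + 1) × y ≡ 2 ^ k))
parametrised[c≡3]-ℓ≡1-e≡1 {k} {x} {y} = mk⇔ classify construct
  where
  classify : Parametrised 3 k 1 1 x y → (x ≡ 2 × y ≡ 2) ⊎ (x ≡ 2 ^ (k + 1) × y ≡ 2 ^ k)
  classify p with parametrised[c≡3]-ℓ≡1 (s≤s z≤n) p
  ... | inj₁ (x≡2 , y≡2 , _) = inj₁ (x≡2 , y≡2)
  ... | inj₂ (j , x≡2ʲ⁺¹ , y≡2ʲ , k≡j*1) with refl ← trans k≡j*1 (*-identityʳ j) = inj₂ (x≡2ʲ⁺¹ , y≡2ʲ)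
  construct : (x ≡ 2 × y ≡ 2) ⊎ (x ≡ 2 ^ (k + 1) × y ≡ 2 ^ k) → Parametrised 3 k 1 1 x y
  construct (inj₁ (refl , refl)) = diagonal-parametrised
  construct (inj₂ (refl , refl)) = power-of-two-parametrised k (sym (*-identityʳ k))

parametrised[c≡3]-ℓ≡1-e≥2⇒shape : ∀ {k e x y} → 1 ≤ k → 2 ≤ e → Parametrised 3 k 1 e x y →
  ∃[ ρ ] ∃[ v ] (1 ≤ ρ × 1 ≤ v × k ≡ ρ * v × k + 1 + e ≡ 1 + v * ρ + v × k + 1 ≡ ρ * v + 1)
parametrised[c≡3]-ℓ≡1-e≥2⇒shape {e = e} k≥1 e≥2 p
  with parametrised[c≡3]-ℓ≡1 (≤-trans (s≤s z≤n) e≥2) p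
... | inj₁ (_ , _ , refl) = ⊥-elim (<-irrefl refl e≥2)
... | inj₂ (zero , _ , _ , refl) = ⊥-elim (<-irrefl refl k≥1)
... | inj₂ (ρ@(suc _) , _ , _ , refl) = ρ , e , s≤s z≤n , ≤-trans (s≤s z≤n) e≥2 , refl ,
  cong (_+ e) (trans (+-comm (ρ * e) 1) (cong suc (*-comm ρ e))) , refl

parametrised[c≡3]-ℓ≡1-e≥2 : ∀ {k e x y} ρ → 2 ≤ e → k ≡ ρ * e →
  Parametrised 3 k 1 e x y ⇔ (x ≡ 2 ^ (ρ + 1) × y ≡ 2 ^ ρ)
parametrised[c≡3]-ℓ≡1-e≥2 {k} {e} {x} {y} ρ e≥2 k≡ρ*e = mk⇔ classify construct
  where
  classify : Parametrised 3 k 1 e x y → x ≡ 2 ^ (ρ + 1) × y ≡ 2 ^ ρ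
  classify p with parametrised[c≡3]-ℓ≡1 (≤-trans (s≤s z≤n) e≥2) p
  ... | inj₁ (_ , _ , refl) = ⊥-elim (<-irrefl refl e≥2)
  ... | inj₂ (j , x≡2ʲ⁺¹ , y≡2ʲ , k≡j*e)
    with refl ← *-cancelʳ-≡ j ρ e {{>-nonZero (≤-trans (s≤s z≤n) e≥2)}} (trans (sym k≡j*e) k≡ρ*e)
    = x≡2ʲ⁺¹ , y≡2ʲ
  construct : x ≡ 2 ^ (ρ + 1) × y ≡ 2 ^ ρ → Parametrised 3 k 1 e x y
  construct (refl , refl) = power-of-two-parametrised ρ k≡ρ*e

shape⇒e≡v : ∀ {k e} ρ v → k ≡ ρ * v → k + 1 + e ≡ 1 + v * ρ + v → e ≡ v
shape⇒e≡v {k} {e} ρ v k≡ρ*v m≡ = +-cancelˡ-≡ (k + 1) e v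
  (trans m≡ (cong (_+ v) (trans (cong suc (trans (*-comm v ρ) (sym k≡ρ*v))) (+-comm 1 k))))

theorem5 : ∀ (n m k ℓ c : ℕ) → 1 ≤ n → 1 ≤ m → 1 ≤ k → 1 ≤ ℓ → 1 ≤ c →
    n ≡ k + ℓ → n < m →
    -- (i)
    (c ≡ 1 → ∀ x y → 1 ≤ x → 1 ≤ y → ¬ Eqn n m k ℓ c x y)
    -- (ii)
    × (2 ≤ c → ∀ M → IsLargestBelow (n ∸ k) c M → ∀ x y → 1 ≤ x → 1 ≤ y →
        (Eqn n m k ℓ c x y ⇔
          (∃[ x₁ ] ∃[ r ] ∃[ d ] (1 ≤ x₁ × 1 ≤ r × 1 ≤ d × x₁ ≤ M
            × x₁ ^ (n ∸ k) + r ≡ c × d ^ (m ∸ n) ≡ r * x₁ ^ k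
            × x ≡ d * x₁ × y ≡ d))))
    -- (iii)
    × (c ≡ 2 → ∀ x y → 1 ≤ x → 1 ≤ y → (Eqn n m k ℓ c x y ⇔ (x ≡ 1 × y ≡ 1)))
    -- (iv)
    × (c ≡ 3 → 2 ≤ n ∸ k → m ∸ n ≡ 1 → ∀ x y → 1 ≤ x → 1 ≤ y →
        (Eqn n m k ℓ c x y ⇔ (x ≡ 2 × y ≡ 2)))
    -- (v)
    × (c ≡ 3 → 2 ≤ n ∸ k → 2 ≤ m ∸ n → ∀ x y → 1 ≤ x → 1 ≤ y → ¬ Eqn n m k ℓ c x y)
    -- (vi)
    × (c ≡ 3 → n ∸ k ≡ 1 → m ∸ n ≡ 1 → ∀ x y → 1 ≤ x → 1 ≤ y →
        (Eqn n m k ℓ c x y ⇔ ((x ≡ 2 × y ≡ 2) ⊎ (x ≡ 2 ^ (k + 1) × y ≡ 2 ^ k))))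
    -- (vii)
    × (c ≡ 3 → n ∸ k ≡ 1 → 2 ≤ m ∸ n →
        ((¬ (∃[ ρ ] ∃[ v ] (1 ≤ ρ × 1 ≤ v × k ≡ ρ * v × m ≡ ℓ + v * ρ + v × n ≡ ρ * v + ℓ))
            → ∀ x y → 1 ≤ x → 1 ≤ y → ¬ Eqn n m k ℓ c x y)
         × (∀ ρ v → 1 ≤ ρ → 1 ≤ v → k ≡ ρ * v → m ≡ ℓ + v * ρ + v → n ≡ ρ * v + ℓ →
            ∀ x y → 1 ≤ x → 1 ≤ y →
              (Eqn n m k ℓ c x y ⇔ (x ≡ 2 ^ (ρ + 1) × y ≡ 2 ^ ρ)))))
theorem5 .(k + ℓ) m k ℓ c _ _ k≥1 ℓ≥1 _ refl n<m
  with m ∸ (k + ℓ) | m+[n∸m]≡n (<⇒≤ n<m) | m<n⇒0<n∸m n<m | k + ℓ ∸ k | m+n∸m≡n k ℓ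
... | e | refl | e≥1 | _ | refl =
    (λ { refl _ _ x≥1 _ → <-irrefl refl ∘ parametrised⇒2≤c ∘ to (solution⇔ x≥1) })
  , (λ _ _ M-largest _ _ x≥1 _ → ⇔-trans (solution⇔ x≥1) (parametrised⇔bounded M-largest))
  , (λ { refl _ _ x≥1 _ → ⇔-trans (solution⇔ x≥1) (parametrised[c≡2] ℓ≥1 e≥1) })
  , (λ { refl ℓ≥2 refl _ _ x≥1 _ → ⇔-trans (solution⇔ x≥1) (parametrised[c≡3]-ℓ≥2-e≡1 ℓ≥2) })
  , (λ { refl ℓ≥2 e≥2 _ _ x≥1 _ s →
         let _ , _ , e≡1 = parametrised[c≡3]-ℓ≥2 ℓ≥2 (to (solution⇔ x≥1) s)
         in <-irrefl refl (subst (2 ≤_) e≡1 e≥2) })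
  , (λ { refl refl refl _ _ x≥1 _ → ⇔-trans (solution⇔ x≥1) parametrised[c≡3]-ℓ≡1-e≡1 })
  , (λ { refl refl e≥2 →
           (λ no-shape _ _ x≥1 _ →
              no-shape ∘ parametrised[c≡3]-ℓ≡1-e≥2⇒shape k≥1 e≥2 ∘ to (solution⇔ x≥1))
         , (λ ρ v _ _ k≡ρ*v m≡ _ _ _ x≥1 _ → ⇔-trans (solution⇔ x≥1)
              (parametrised[c≡3]-ℓ≡1-e≥2 ρ e≥2
                (trans k≡ρ*v (cong (ρ *_) (sym (shape⇒e≡v ρ v k≡ρ*v m≡)))))) })
  where
  solution⇔ : ∀ {x y} → 1 ≤ x → Eqn (k + ℓ) (k + ℓ + e) k ℓ c x y ⇔ Parametrised c k ℓ e x y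
  solution⇔ = solution⇔parametrised ℓ≥1
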